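{- Let $\{\mathsf{ea}\}\subseteq S\subseteq\{\mathsf{ea},\mathsf{ed}\}$, let $G=(V,E)$ be a digraph and $\delta\colon V\to\mathbb Z$. Then: (i) if $F$ is a minimum directed $f$-join in $G_S$, then $(A_F,D_F)$ is a semi-solution for $(G,\delta)$ of size $|F|$; (ii) if $(A,D)$ is a semi-solution for $(G,\delta)$, then $A\uplus D^R$ is a directed $f$-join in $G_S$ of size $|A|+|D|$.
   Context: Digraphs have no loops and no multiple arcs; $d^+_G(v)$, $d^-_G(v)$ denote out- and in-degree. Let $T=\{v\in V: d^+_G(v)-d^-_G(v)\neq\delta(v)\}$ and $f\colon T\to\mathbb Z$, $f(v)=\delta(v)-d^+_G(v)+d^-_G(v)$. The directed multigraph $G_S$ has vertex set $V$ and arcs: for each ordered pair of distinct vertices $u,v$ with $(u,v)\notin E$, an arc $(u,v)$; and, if $S=\{\mathsf{ea},\mathsf{ed}\}$, additionally for each $(u,v)\in E$ an arc $(v,u)$. A multiset $E'$ of arcs of a directed multigraph (each arc copy used at most once), whose spanned vertex set contains $T$, is a directed $f$-join if in the multigraph formed by $E'$ each $v\in T$ has out-degree minus in-degree $f(v)$ and every other spanned vertex has out-degree minus in-degree $0$; minimum means of minimum size. For such $F$, sets $A_F,D_F$ are built from empty: if $F$ contains $(u,v)$ exactly once, add $(u,v)$ to $A_F$ if $(u,v)\notin E$, and add $(v,u)$ to $D_F$ if $(u,v)\in E$; if $F$ contains two copies of $(u,v)$, add $(u,v)$ to $A_F$ and $(v,u)$ to $D_F$. A semi-solution for $(G,\delta)$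 is a pair $(A,D)$ where $A$ is a set of arcs between distinct vertices not in $E$, $D\subseteq E$, $D=\emptyset$ if $S=\{\mathsf{ea}\}$, such that $H=G+A-D$ (add $A$, delete $D$) satisfies $d^+_H(u)-d^-_H(u)=\delta(u)$ for every $u$ (weak connectivity not required); its size is $|A|+|D|$. $D^R=\{(u,v):(v,u)\in D\}$. For sets $X,Y$, $X\uplus Y$ is the multiset containing one copy of each element in exactly one of $X,Y$ and two copies of each element in both. -}

module Defs where

open import Data.Nat using (ℕ; zero; suc; _+_; _≤_; _<_; _≡ᵇ_)
open import Data.Integer using (ℤ; +_; _-_; 0ℤ)
open import Data.Bool using (Bool; true; false; not; _∧_; _∨_; if_then_else_)
open import Data.Fin using (Fin; _≟_)
import Data.Fin as Fin
open import Data.Product using (Σ; _×_)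
open import Data.Sum using (_⊎_)
open import Relation.Nullary using (¬_)
open import Relation.Nullary.Decidable using (⌊_⌋)
open import Relation.Binary.PropositionalEquality using (_≡_; _≢_)

-- A (simple, loopless) digraph is given by its
-- adjacency relation E : Fin n → Fin n → Bool ((u,v) ∈ E iff E u v ≡ true).
-- Sets of arcs are Bool-valued relations; multisets of arcs are ℕ-valued.
Rel : ℕ → Set
Rel n = Fin n → Fin n → Bool

MRel : ℕ → Set
MRel n = Fin n → Fin n → ℕ

data Scen : Set where
  ea   : Scen   -- S = {ea}
  eaed : Scen   -- S = {ea, ed}

b2n : Bool → ℕ
b2n true  = 1
b2n false = 0

sumFin : ∀ {n} → (Fin n → ℕ) → ℕ
sumFin {zero}  f = 0
sumFin {suc n} f = f Fin.zero + sumFin (λ i → f (Fin.suc i))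

outdeg : ∀ {n} → Rel n → Fin n → ℕ
outdeg R u = sumFin (λ v → b2n (R u v))

indeg : ∀ {n} → Rel n → Fin n → ℕ
indeg R u = sumFin (λ v → b2n (R v u))

card : ∀ {n} → Rel n → ℕ
card R = sumFin (λ u → sumFin (λ v → b2n (R u v)))

moutdeg : ∀ {n} → MRel n → Fin n → ℕ
moutdeg M u = sumFin (λ v → M u v)

mindeg : ∀ {n} → MRel n → Fin n → ℕ
mindeg M u = sumFin (λ v → M v u)

msize : ∀ {n} → MRel n → ℕ
msize M = sumFin (λ u → sumFin (λ v → M u v))

InT : ∀ {n} → Rel n → (Fin n → ℤ) → Fin n → Set
InT E δ v = (+ outdeg E v) - (+ indeg E v) ≢ δ v

-- f(v) = δ(v) - d⁺_G(v) + d⁻_G(v)   (only used for v ∈ T)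
fval : ∀ {n} → Rel n → (Fin n → ℤ) → Fin n → ℤ
fval E δ v = δ v - (+ outdeg E v) Data.Integer.+ (+ indeg E v)

-- multiplicity of the arc (u,v) in the directed multigraph G_S:
-- one copy if u ≠ v and (u,v) ∉ E, plus (when S = {ea,ed}) one copy if (v,u) ∈ E.
multGS : ∀ {n} → Scen → Rel n → Fin n → Fin n → ℕ
multGS ea   E u v = b2n (not ⌊ u ≟ v ⌋ ∧ not (E u v))
multGS eaed E u v = b2n (not ⌊ u ≟ v ⌋ ∧ not (E u v)) + b2n (E v u)

Spanned : ∀ {n} → MRel n → Fin n → Set
Spanned M v = Σ _ λ w → (0 < M v w) ⊎ (0 < M w v)

IsDirFJoin : ∀ {n} → Scen → Rel n → (Fin n → ℤ) → MRel n → Set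
IsDirFJoin S E δ M =
  (∀ u v → M u v ≤ multGS S E u v) ×
  (∀ v → InT E δ v → Spanned M v) ×
  (∀ v → InT E δ v → (+ moutdeg M v) - (+ mindeg M v) ≡ fval E δ v) ×
  (∀ v → ¬ InT E δ v → Spanned M v → (+ moutdeg M v) - (+ mindeg M v) ≡ 0ℤ)

IsMinDirFJoin : ∀ {n} → Scen → Rel n → (Fin n → ℤ) → MRel n → Set
IsMinDirFJoin S E δ F =
  IsDirFJoin S E δ F × (∀ F' → IsDirFJoin S E δ F' → msize F ≤ msize F')

AF : ∀ {n} → Rel n → MRel n → Rel n
AF E F u v = ((F u v ≡ᵇ 1) ∧ not (E u v)) ∨ (F u v ≡ᵇ 2)

DF : ∀ {n} → Rel n → MRel n → Rel n
DF E F x y = ((F y x ≡ᵇ 1) ∧ E y x) ∨ (F y x ≡ᵇ 2)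

plusMinus : ∀ {n} → Rel n → Rel n → Rel n → Rel n
plusMinus E A D u v = (E u v ∨ A u v) ∧ not (D u v)

IsSemiSolution : ∀ {n} → Scen → Rel n → (Fin n → ℤ) → Rel n → Rel n → Set
IsSemiSolution S E δ A D =
  (∀ u v → A u v ≡ true → (u ≢ v) × (E u v ≡ false)) ×
  (∀ u v → D u v ≡ true → E u v ≡ true) ×
  (S ≡ ea → ∀ u v → D u v ≡ false) ×
  (∀ u → (+ outdeg (plusMinus E A D) u) - (+ indeg (plusMinus E A D) u) ≡ δ u)

rev : ∀ {n} → Rel n → Rel n
rev D u v = D v u

-- X ⊎ Y as a multiset (one copy if in exactly one, two copies if in both)
mplus : ∀ {n} → Rel n → Rel n → MRel n
mplus X Y u v = b2n (X u v) + b2n (Y u v)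

module Submission where

-- Everything is driven by imbalances (out-degree minus in-degree).  Viewing a set
-- of arcs as a 0/1 multiset, the imbalance is additive under multiset sum and
-- changes sign under reversal.  Hence, if A avoids E and D ⊆ E, the digraph
-- H = G + A - D satisfies  imb H = imb G + imb (A ⊎ D^R)  (surgery-imbalance).
-- So (A, D) fixes all degrees iff M = A ⊎ D^R is "balanced": imb G + imb M = δ.
-- On the join side, the degree and spanning conditions of a directed f-join say
-- exactly that M is balanced, because a vertex met by no arc of M has imbalance
-- 0 in M (balanced⇒join, join⇒balanced).  What remains is arc bookkeeping: a
-- copy of (u,v) in G_S is either a new arc ((u,v) ∉ E, u ≠ v) or the reversal
-- of an arc (v,u) ∈ E; these are exactly the arcs that go into A_F resp. D_F,
-- and A ⊎ D^R stays within these capacities.  Part (i) holds for every directed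
-- f-join.

open import Defs
open import Data.Nat using (ℕ; zero; suc; _+_; _≤_; z≤n; s≤s; _≡ᵇ_)
import Data.Nat.Properties as ℕ
open import Data.Integer using (ℤ; +_; 0ℤ)
import Data.Integer as ℤ
import Data.Integer.Properties as ℤP
open import Data.Integer.Solver using (module +-*-Solver)
open import Algebra.Properties.CommutativeSemigroup ℕ.+-commutativeSemigroup using (interchange)
open import Data.Bool using (Bool; true; false; not; _∧_; _∨_)
open import Data.Bool.Properties using (¬-not)
open import Data.Fin using (Fin; _≟_)
import Data.Fin as Fin
open import Data.Fin.Properties using (any?)
open import Data.Product using (_×_; _,_; proj₁; proj₂)
open import Data.Sum using (inj₁; inj₂)
open import Function using (_∘_)
open import Relation.Nullary using (¬_; Dec; yes; no; contradiction)
open import Relation.Nullary.Decidable using (⌊_⌋; _⊎-dec_; decidable-stable)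
open import Relation.Binary.PropositionalEquality
  using (_≡_; _≢_; refl; sym; trans; cong; cong₂; subst; module ≡-Reasoning)

sumFin-cong : ∀ {n} {f g : Fin n → ℕ} → (∀ i → f i ≡ g i) → sumFin f ≡ sumFin g
sumFin-cong {zero}  f≗g = refl
sumFin-cong {suc n} f≗g = cong₂ _+_ (f≗g Fin.zero) (sumFin-cong (f≗g ∘ Fin.suc))

sumFin-zero : ∀ {n} {f : Fin n → ℕ} → (∀ i → f i ≡ 0) → sumFin f ≡ 0
sumFin-zero {zero}  f≗0 = refl
sumFin-zero {suc n} f≗0 = cong₂ _+_ (f≗0 Fin.zero) (sumFin-zero (f≗0 ∘ Fin.suc))

sumFin-+ : ∀ {n} (f g : Fin n → ℕ) → sumFin (λ i → f i + g i) ≡ sumFin f + sumFin g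
sumFin-+ {zero}  f g = refl
sumFin-+ {suc n} f g =
  trans (cong (_+_ (f Fin.zero + g Fin.zero)) (sumFin-+ (f ∘ Fin.suc) (g ∘ Fin.suc)))
        (interchange (f Fin.zero) (g Fin.zero) (sumFin (f ∘ Fin.suc)) (sumFin (g ∘ Fin.suc)))

sumFin-swap : ∀ {m n} (f : Fin m → Fin n → ℕ) →
  sumFin (λ u → sumFin (λ v → f u v)) ≡ sumFin (λ v → sumFin (λ u → f u v))
sumFin-swap {zero}  f = sym (sumFin-zero {f = λ v → sumFin (λ u → f u v)} (λ _ → refl))
sumFin-swap {suc m} f =
  trans (cong (_+_ (sumFin (f Fin.zero))) (sumFin-swap (f ∘ Fin.suc)))
        (sym (sumFin-+ (f Fin.zero) (λ v → sumFin (λ u → f (Fin.suc u) v))))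

module IntegerAlgebra where
  open +-*-Solver

  minus-interchange : ∀ a b c d → (a ℤ.+ b) ℤ.- (c ℤ.+ d) ≡ (a ℤ.- c) ℤ.+ (b ℤ.- d)
  minus-interchange = solve 4 (λ a b c d → (a :+ b) :- (c :+ d) := (a :- c) :+ (b :- d)) refl

  minus-swap : ∀ a b → b ℤ.- a ≡ ℤ.- (a ℤ.- b)
  minus-swap = solve 2 (λ a b → b :- a := :- (a :- b)) refl

  isolate : ∀ x d e a → x ℤ.+ d ≡ e ℤ.+ a → x ≡ e ℤ.+ (a ℤ.+ ℤ.- d)
  isolate x d e a eq = begin
    x                            ≡⟨ solve 2 (λ x d → x := (x :+ d) :- d) refl x d ⟩
    (x ℤ.+ d) ℤ.- d              ≡⟨ cong (ℤ._- d) eq ⟩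
    (e ℤ.+ a) ℤ.- d              ≡⟨ solve 3 (λ e a d → (e :+ a) :- d := e :+ (a :+ :- d)) refl e a d ⟩
    e ℤ.+ (a ℤ.+ ℤ.- d)          ∎
    where open ≡-Reasoning

  cancel : ∀ x m → x ℤ.+ m ≡ x → m ≡ 0ℤ
  cancel x m eq = begin
    m                    ≡⟨ solve 2 (λ x m → m := (x :+ m) :- x) refl x m ⟩
    (x ℤ.+ m) ℤ.- x      ≡⟨ cong (ℤ._- x) eq ⟩
    x ℤ.- x              ≡⟨ ℤP.+-inverseʳ x ⟩
    0ℤ                   ∎
    where open ≡-Reasoning

  -- (o - i) + m = d  ⇔  m = d - o + i   (the shape of f(v) = δ(v) - d⁺(v) + d⁻(v))
  solve-demand : ∀ o i d m → (o ℤ.- i) ℤ.+ m ≡ d → m ≡ d ℤ.- o ℤ.+ i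
  solve-demand o i d m eq = begin
    m                                ≡⟨ solve 3 (λ o i m → m := ((o :- i) :+ m) :- o :+ i) refl o i m ⟩
    ((o ℤ.- i) ℤ.+ m) ℤ.- o ℤ.+ i    ≡⟨ cong (λ x → x ℤ.- o ℤ.+ i) eq ⟩
    d ℤ.- o ℤ.+ i                    ∎
    where open ≡-Reasoning

  meet-demand : ∀ o i d → (o ℤ.- i) ℤ.+ (d ℤ.- o ℤ.+ i) ≡ d
  meet-demand = solve 3 (λ o i d → (o :- i) :+ (d :- o :+ i) := d) refl

open IntegerAlgebra

b2n≤1 : ∀ b → b2n b ≤ 1
b2n≤1 true  = s≤s z≤n
b2n≤1 false = z≤n

b2n-mono : ∀ {a b} → (a ≡ true → b ≡ true) → b2n a ≤ b2n b
b2n-mono {false}         _   = z≤n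
b2n-mono {true}  {true}  _   = s≤s z≤n
b2n-mono {true}  {false} a⇒b with a⇒b refl
... | ()

toM : ∀ {n} → Rel n → MRel n
toM R u v = b2n (R u v)

-- Sum of multisets; note  mplus X Y = toM X ⊕ toM Y.
_⊕_ : ∀ {n} → MRel n → MRel n → MRel n
(M ⊕ N) u v = M u v + N u v

mimb : ∀ {n} → MRel n → Fin n → ℤ
mimb M u = + moutdeg M u ℤ.- + mindeg M u

-- Imbalance in a digraph; InT E δ v is literally  imb E v ≢ δ v.
imb : ∀ {n} → Rel n → Fin n → ℤ
imb R = mimb (toM R)

mimb-cong : ∀ {n} {M N : MRel n} → (∀ u v → M u v ≡ N u v) → ∀ u → mimb M u ≡ mimb N u
mimb-cong M≐N u =
  cong₂ (λ o i → + o ℤ.- + i) (sumFin-cong (M≐N u)) (sumFin-cong (λ v → M≐N v u))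

mimb-⊕ : ∀ {n} (M N : MRel n) u → mimb (M ⊕ N) u ≡ mimb M u ℤ.+ mimb N u
mimb-⊕ M N u = begin
  + moutdeg (M ⊕ N) u ℤ.- + mindeg (M ⊕ N) u
    ≡⟨ cong₂ (λ o i → + o ℤ.- + i) (sumFin-+ (M u) (N u)) (sumFin-+ (λ v → M v u) (λ v → N v u)) ⟩
  + (moutdeg M u + moutdeg N u) ℤ.- + (mindeg M u + mindeg N u)
    ≡⟨ cong₂ ℤ._-_ (ℤP.pos-+ (moutdeg M u) (moutdeg N u)) (ℤP.pos-+ (mindeg M u) (mindeg N u)) ⟩
  (+ moutdeg M u ℤ.+ + moutdeg N u) ℤ.- (+ mindeg M u ℤ.+ + mindeg N u)
    ≡⟨ minus-interchange (+ moutdeg M u) (+ moutdeg N u) (+ mindeg M u) (+ mindeg N u) ⟩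
  mimb M u ℤ.+ mimb N u ∎
  where open ≡-Reasoning

imb-rev : ∀ {n} (R : Rel n) u → imb (rev R) u ≡ ℤ.- imb R u
imb-rev R u = minus-swap (+ outdeg R u) (+ indeg R u)

unspanned-balanced : ∀ {n} (M : MRel n) v → ¬ Spanned M v → mimb M v ≡ 0ℤ
unspanned-balanced M v unspanned =
  cong₂ (λ o i → + o ℤ.- + i) (sumFin-zero no-out) (sumFin-zero no-in)
  where
  no-out : ∀ w → M v w ≡ 0
  no-out w = ℕ.n≤0⇒n≡0 (ℕ.≮⇒≥ (λ pos → unspanned (w , inj₁ pos)))
  no-in : ∀ w → M w v ≡ 0
  no-in w = ℕ.n≤0⇒n≡0 (ℕ.≮⇒≥ (λ pos → unspanned (w , inj₂ pos)))

spanned? : ∀ {n} (M : MRel n) v → Dec (Spanned M v)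
spanned? M v = any? (λ w → (0 ℕ.<? M v w) ⊎-dec (0 ℕ.<? M w v))

msize-cong : ∀ {n} {M N : MRel n} → (∀ u v → M u v ≡ N u v) → msize M ≡ msize N
msize-cong M≐N = sumFin-cong (λ u → sumFin-cong (M≐N u))

msize-⊕ : ∀ {n} (M N : MRel n) → msize (M ⊕ N) ≡ msize M + msize N
msize-⊕ M N = trans (sumFin-cong (λ u → sumFin-+ (M u) (N u)))
                    (sumFin-+ (λ u → sumFin (M u)) (λ u → sumFin (N u)))

card-rev : ∀ {n} (R : Rel n) → card (rev R) ≡ card R
card-rev R = sym (sumFin-swap (toM R))

mplus-size : ∀ {n} (A D : Rel n) → msize (mplus A (rev D)) ≡ card A + card D
mplus-size A D = trans (msize-⊕ (toM A) (toM (rev D))) (cong (_+_ (card A)) (card-rev D))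

Balanced : ∀ {n} → Rel n → (Fin n → ℤ) → MRel n → Set
Balanced E δ M = ∀ u → imb E u ℤ.+ mimb M u ≡ δ u

JoinConditions : ∀ {n} → Rel n → (Fin n → ℤ) → MRel n → Set
JoinConditions E δ M =
  (∀ v → InT E δ v → Spanned M v) ×
  (∀ v → InT E δ v → mimb M v ≡ fval E δ v) ×
  (∀ v → ¬ InT E δ v → Spanned M v → mimb M v ≡ 0ℤ)

balanced⇒join : ∀ {n} (E : Rel n) δ M → Balanced E δ M → JoinConditions E δ M
balanced⇒join E δ M balanced = spans , demand , settled
  where
  spans : ∀ v → InT E δ v → Spanned M v
  spans v v∈T = decidable-stable (spanned? M v) λ unspanned →
    v∈T (trans (sym (ℤP.+-identityʳ (imb E v)))
               (trans (cong (ℤ._+_ (imb E v)) (sym (unspanned-balanced M v unspanned))) (balanced v)))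
  demand : ∀ v → InT E δ v → mimb M v ≡ fval E δ v
  demand v _ = solve-demand (+ outdeg E v) (+ indeg E v) (δ v) (mimb M v) (balanced v)
  settled : ∀ v → ¬ InT E δ v → Spanned M v → mimb M v ≡ 0ℤ
  settled v v∉T _ =
    cancel (imb E v) (mimb M v) (trans (balanced v) (sym (decidable-stable (imb E v ℤP.≟ δ v) v∉T)))

join⇒balanced : ∀ {n} (E : Rel n) δ M → JoinConditions E δ M → Balanced E δ M
join⇒balanced E δ M (spans , demand , settled) u with imb E u ℤP.≟ δ u
... | no u∈T = trans (cong (ℤ._+_ (imb E u)) (demand u u∈T)) (meet-demand (+ outdeg E u) (+ indeg E u) (δ u))
... | yes u∉T = trans (cong (ℤ._+_ (imb E u)) balanced-in-M) (trans (ℤP.+-identityʳ (imb E u)) u∉T)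
  where
  balanced-in-M : mimb M u ≡ 0ℤ
  balanced-in-M with spanned? M u
  ... | yes spanned  = settled u (λ u∈T → u∈T u∉T) spanned
  ... | no unspanned = unspanned-balanced M u unspanned

surgery-arc : (e a d : Bool) → (a ≡ true → e ≡ false) → (d ≡ true → e ≡ true) →
  b2n ((e ∨ a) ∧ not d) + b2n d ≡ b2n e + b2n a
surgery-arc true  true  _     a∉E _   with a∉E refl
... | ()
surgery-arc true  false true  _   _   = refl
surgery-arc true  false false _   _   = refl
surgery-arc false _     true  _   d⊆E with d⊆E refl
... | ()
surgery-arc false true  false _   _   = refl
surgery-arc false false false _   _   = refl

surgery-imbalance : ∀ {n} (E A D : Rel n) →
  (∀ u v → A u v ≡ true → E u v ≡ false) → (∀ u v → D u v ≡ true → E u v ≡ true) →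
  ∀ u → imb (plusMinus E A D) u ≡ imb E u ℤ.+ mimb (mplus A (rev D)) u
surgery-imbalance E A D A∉E D⊆E u = begin
  imb H u                                   ≡⟨ isolate (imb H u) (imb D u) (imb E u) (imb A u) H+D≡E+A ⟩
  imb E u ℤ.+ (imb A u ℤ.+ ℤ.- imb D u)     ≡⟨ cong (λ x → imb E u ℤ.+ (imb A u ℤ.+ x)) (sym (imb-rev D u)) ⟩
  imb E u ℤ.+ (imb A u ℤ.+ imb (rev D) u)   ≡⟨ cong (ℤ._+_ (imb E u)) (sym (mimb-⊕ (toM A) (toM (rev D)) u)) ⟩
  imb E u ℤ.+ mimb (mplus A (rev D)) u      ∎
  where
  open ≡-Reasoning
  H = plusMinus E A D
  H+D≡E+A : imb H u ℤ.+ imb D u ≡ imb E u ℤ.+ imb A u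
  H+D≡E+A = begin
    imb H u ℤ.+ imb D u           ≡⟨ sym (mimb-⊕ (toM H) (toM D) u) ⟩
    mimb (toM H ⊕ toM D) u        ≡⟨ mimb-cong (λ x y → surgery-arc (E x y) (A x y) (D x y) (A∉E x y) (D⊆E x y)) u ⟩
    mimb (toM E ⊕ toM A) u        ≡⟨ mimb-⊕ (toM E) (toM A) u ⟩
    imb E u ℤ.+ imb A u           ∎

newArc : ∀ {n} → Rel n → Rel n
newArc E u v = not ⌊ u ≟ v ⌋ ∧ not (E u v)

revArc : ∀ {n} → Scen → Rel n → Rel n
revArc ea   E u v = false
revArc eaed E u v = E v u

multGS-split : ∀ {n} S (E : Rel n) u v → multGS S E u v ≡ b2n (newArc E u v) + b2n (revArc S E u v)
multGS-split ea   E u v = sym (ℕ.+-identityʳ _)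
multGS-split eaed E u v = refl

newArc-sound : ∀ {n} (E : Rel n) u v → newArc E u v ≡ true → (u ≢ v) × (E u v ≡ false)
newArc-sound E u v new with u ≟ v | E u v
newArc-sound E u v ()  | yes _   | _
newArc-sound E u v ()  | no _    | true
newArc-sound E u v _   | no u≢v  | false = u≢v , refl

newArc-complete : ∀ {n} (E : Rel n) u v → u ≢ v → E u v ≡ false → newArc E u v ≡ true
newArc-complete E u v u≢v uv∉E with u ≟ v
... | yes u≡v = contradiction u≡v u≢v
... | no _    = cong not uv∉E

revArc-sound : ∀ {n} S (E : Rel n) u v → revArc S E u v ≡ true → E v u ≡ true
revArc-sound eaed E u v vu∈E = vu∈E

no-revArc : ∀ {n} {S} (E : Rel n) u v → S ≡ ea → revArc S E u v ≢ true
no-revArc E u v refl ()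

revArc⇒newArc : ∀ {n} S (E : Rel n) → (∀ v → E v v ≡ false) →
  ∀ u v → revArc S E u v ≡ true → E u v ≡ false → newArc E u v ≡ true
revArc⇒newArc eaed E loopless u v vu∈E uv∉E = newArc-complete E u v u≢v uv∉E
  where
  u≢v : u ≢ v
  u≢v refl with trans (sym (loopless u)) vu∈E
  ... | ()

deletion⇒revArc : ∀ {n} S (E D : Rel n) → (∀ u v → D u v ≡ true → E u v ≡ true) →
  (S ≡ ea → ∀ u v → D u v ≡ false) → ∀ u v → D v u ≡ true → revArc S E u v ≡ true
deletion⇒revArc ea   E D _   noDel u v del with trans (sym (noDel refl v u)) del
... | ()
deletion⇒revArc eaed E D D⊆E _     u v del = D⊆E v u del

-- For k copies of (u,v) in F and e = [(u,v) ∈ E]:  AF E F u v = addOf k e,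
-- DF E F v u = delOf k e.
addOf : ℕ → Bool → Bool
addOf k e = ((k ≡ᵇ 1) ∧ not e) ∨ (k ≡ᵇ 2)

delOf : ℕ → Bool → Bool
delOf k e = ((k ≡ᵇ 1) ∧ e) ∨ (k ≡ᵇ 2)

count-split : ∀ k e → k ≤ 2 → k ≡ b2n (addOf k e) + b2n (delOf k e)
count-split 0 true  _ = refl
count-split 0 false _ = refl
count-split 1 true  _ = refl
count-split 1 false _ = refl
count-split 2 e     _ = refl
count-split (suc (suc (suc k))) e (s≤s (s≤s ()))

capacity≤2 : ∀ {k} a r → k ≤ b2n a + b2n r → k ≤ 2
capacity≤2 a r k≤ = ℕ.≤-trans k≤ (ℕ.+-mono-≤ (b2n≤1 a) (b2n≤1 r))

-- In the next two lemmas a and r say whether a new-arc resp. reversal copy of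
-- (u,v) exists in G_S, and k ≤ a + r is the capacity constraint on F.

addOf-sound : ∀ k a r e → (r ≡ true → e ≡ false → a ≡ true) →
  k ≤ b2n a + b2n r → addOf k e ≡ true → a ≡ true
addOf-sound k       true  r     e     _     _           _   = refl
addOf-sound zero    false r     e     _     _           ()
addOf-sound (suc k) false false e     _     ()          _
addOf-sound 1       false true  true  _     _           ()
addOf-sound 1       false true  false r⇒a   _           _   = r⇒a refl refl
addOf-sound (suc (suc k)) false true e _    (s≤s ())    _

delOf-sound : ∀ k a r e → (a ≡ true → e ≡ false) →
  k ≤ b2n a + b2n r → delOf k e ≡ true → r ≡ true
delOf-sound k       a     true  e     _     _           _   = refl
delOf-sound zero    a     false e     _     _           ()
delOf-sound (suc k) false false e     _     ()          _
delOf-sound 1       true  false false _     _           ()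
delOf-sound 1       true  false true  a⇒e   _           _ with a⇒e refl
... | ()
delOf-sound (suc (suc k)) true false e _    (s≤s ())    _

join⇒semiSolution : ∀ S {n} (E : Rel n) → (∀ v → E v v ≡ false) → (δ : Fin n → ℤ) →
  (F : MRel n) → IsDirFJoin S E δ F →
  IsSemiSolution S E δ (AF E F) (DF E F) × (card (AF E F) + card (DF E F) ≡ msize F)
join⇒semiSolution S E loopless δ F (fits , conditions) =
  (A-new , D⊆E , no-deletions , degrees) , sym (trans (msize-cong F≐M) (mplus-size A D))
  where
  A = AF E F
  D = DF E F
  capacity : ∀ u v → F u v ≤ b2n (newArc E u v) + b2n (revArc S E u v)
  capacity u v = subst (F u v ≤_) (multGS-split S E u v) (fits u v)
  F≐M : ∀ u v → F u v ≡ mplus A (rev D) u v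
  F≐M u v = count-split (F u v) (E u v) (capacity≤2 (newArc E u v) (revArc S E u v) (capacity u v))
  A-new : ∀ u v → A u v ≡ true → (u ≢ v) × (E u v ≡ false)
  A-new u v add = newArc-sound E u v
    (addOf-sound (F u v) _ _ (E u v) (revArc⇒newArc S E loopless u v) (capacity u v) add)
  D-rev : ∀ u v → D u v ≡ true → revArc S E v u ≡ true
  D-rev u v del = delOf-sound (F v u) _ _ (E v u) (proj₂ ∘ newArc-sound E v u) (capacity v u) del
  D⊆E : ∀ u v → D u v ≡ true → E u v ≡ true
  D⊆E u v del = revArc-sound S E v u (D-rev u v del)
  no-deletions : S ≡ ea → ∀ u v → D u v ≡ false
  no-deletions S≡ea u v = ¬-not (no-revArc E v u S≡ea ∘ D-rev u v)
  degrees : ∀ u → imb (plusMinus E A D) u ≡ δ u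
  degrees u = begin
    imb (plusMinus E A D) u              ≡⟨ surgery-imbalance E A D (λ x y → proj₂ ∘ A-new x y) D⊆E u ⟩
    imb E u ℤ.+ mimb (mplus A (rev D)) u ≡⟨ cong (ℤ._+_ (imb E u)) (sym (mimb-cong F≐M u)) ⟩
    imb E u ℤ.+ mimb F u                 ≡⟨ join⇒balanced E δ F conditions u ⟩
    δ u                                  ∎
    where open ≡-Reasoning

semiSolution⇒join : ∀ S {n} (E : Rel n) (δ : Fin n → ℤ) (A D : Rel n) → IsSemiSolution S E δ A D →
  IsDirFJoin S E δ (mplus A (rev D)) × (msize (mplus A (rev D)) ≡ card A + card D)
semiSolution⇒join S E δ A D (A-new , D⊆E , no-deletions , degrees) =
  (fits , balanced⇒join E δ (mplus A (rev D)) balanced) , mplus-size A D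
  where
  fits : ∀ u v → mplus A (rev D) u v ≤ multGS S E u v
  fits u v = subst (mplus A (rev D) u v ≤_) (sym (multGS-split S E u v))
    (ℕ.+-mono-≤ (b2n-mono (λ add → newArc-complete E u v (proj₁ (A-new u v add)) (proj₂ (A-new u v add))))
                (b2n-mono (deletion⇒revArc S E D D⊆E no-deletions u v)))
  balanced : Balanced E δ (mplus A (rev D))
  balanced u = trans (sym (surgery-imbalance E A D (λ x y → proj₂ ∘ A-new x y) D⊆E u)) (degrees u)

lemma4p2 : (S : Scen) (n : ℕ) (E : Rel n) → (∀ v → E v v ≡ false) → (δ : Fin n → ℤ) →
    ((F : MRel n) → IsMinDirFJoin S E δ F →
        IsSemiSolution S E δ (AF E F) (DF E F) × (card (AF E F) + card (DF E F) ≡ msize F))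
    ×
    ((A D : Rel n) → IsSemiSolution S E δ A D →
        IsDirFJoin S E δ (mplus A (rev D)) × (msize (mplus A (rev D)) ≡ card A + card D))
lemma4p2 S n E loopless δ =
  (λ F minimum → join⇒semiSolution S E loopless δ F (proj₁ minimum)) ,
  semiSolution⇒join S E δ
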